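{- For every $n\ge1$, the number of integer sequences $e=(e_1,\dots,e_n)$ with $0\le e_i<i$ for all $i$ having no indices $i<j<k$ with $e_j>e_k$ and $e_i>e_k$ equals the number of such sequences having no indices $i<j<k$ with $e_i\ne e_j$, $e_j\ge e_k$ and $e_i>e_k$. -}

module Defs where

open import Data.Nat using (ℕ; zero; suc; _<_; _>_; _≥_; _<?_; _≤?_)
open import Data.List using (List; []; _∷_; map; concatMap; upTo; length; filter; _++_; [_])
open import Data.Fin using (Fin; toℕ)
open import Data.Product using (∃-syntax; _×_)
open import Relation.Nullary using (¬_; Dec)
open import Relation.Binary.PropositionalEquality using (_≢_)

-- An inversion sequence of length n is a list e = (e_1, …, e_n) of naturals
-- with 0 ≤ e_i < i. invSeqs n enumerates all of them (each exactly once):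
-- a length-(n+1) inversion sequence is a length-n one extended by a last
-- entry e_{n+1} ∈ {0, …, n}.
invSeqs : ℕ → List (List ℕ)
invSeqs zero = [] ∷ []
invSeqs (suc n) = concatMap (λ e → map (λ x → e ++ [ x ]) (upTo (suc n))) (invSeqs n)

-- 0-based entry lookup (out of range gives 0, never used for in-range indices)
at : List ℕ → ℕ → ℕ
at [] _ = 0
at (x ∷ _) zero = x
at (_ ∷ xs) (suc i) = at xs i

Occ1 : List ℕ → Set
Occ1 e = ∃[ i ] ∃[ j ] ∃[ k ] (i < j × j < k × k < length e
         × at e j > at e k × at e i > at e k)

Occ2 : List ℕ → Set
Occ2 e = ∃[ i ] ∃[ j ] ∃[ k ] (i < j × j < k × k < length e
         × at e i ≢ at e j × at e j ≥ at e k × at e i > at e k)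

count : (P : List ℕ → Set) → ((e : List ℕ) → Dec (P e)) → ℕ → ℕ
count P P? n = length (filter P? (invSeqs n))

module Submission where

-- Both classes are recognised by reading e from left to right while keeping a
-- threshold L: an entry x may be appended to an avoider iff x ≥ L.  For pattern
-- 1, L is the second largest entry (counted with multiplicity), and the pair
-- (M, L), M the largest entry, determines its own update.  For pattern 2 this
-- also needs the largest entry R different from M.  The succession rules are
--   pattern 1:  (M, L)    ↦ (M, x)            for L ≤ x ≤ M,   (x, M)    for x > M;
--   pattern 2:  (M, R, L) ↦ (M, R ⊔ x, x + 1) for L ≤ x < M,   (M, R, L) for x = M,
--                                                              (x, M, M) for x > M.
-- Forgetting R, the children of (M, R, L) are those of (M, L) with the block
-- x ∈ [L, M] cyclically shifted, so by induction on the number of entries still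
-- to be appended a label (M, R, L) with R ≤ L has exactly as many descendants
-- as (M, L), whatever R is.

open import Defs
open import Data.Bool using (Bool; true; false; _∧_; T; if_then_else_)
open import Data.Bool.Properties using (∧-zeroʳ)
open import Data.List
  using (List; []; _∷_; _++_; _∷ʳ_; length; map; concatMap; upTo; applyUpTo; filter; foldl)
open import Data.List.Properties
  using (length-++; foldl-∷ʳ; map-++; map-upTo; map-∘; map-cong; filter-≐)
open import Data.List.Reverse using (Reverse; []; _∶_∶ʳ_; reverseView)
open import Data.Nat
open import Data.Nat.ListAction using (sum)
open import Data.Nat.ListAction.Properties using (sum-++)
open import Data.Nat.Properties
open import Data.Product using (∃-syntax; _×_; _,_; proj₁; proj₂; uncurry)
open import Data.Product.Function.NonDependent.Propositional using (_×-⇔_)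
open import Data.Sum using (_⊎_; inj₁; inj₂; [_,_])
open import Data.Sum.Function.Propositional using (_⊎-⇔_)
open import Data.Unit using (tt)
open import Function using (id; _∘_; case_of_; _⇔_; mk⇔; Equivalence)
open import Function.Construct.Identity using (⇔-id)
open import Function.Properties.Equivalence using () renaming (trans to ⇔-trans)
open import Function.Related.Propositional using (equivalence; module EquationalReasoning)
open import Relation.Binary using (tri<; tri≈; tri>)
open import Relation.Binary.PropositionalEquality hiding ([_])
open import Relation.Nullary using (¬_; Dec; yes; no; does; contradiction)
open import Relation.Nullary.Decidable using (T?; dec-true; dec-false)

SomeEntry : (ℕ → Set) → List ℕ → Set
SomeEntry P e = ∃[ i ] (i < length e × P (at e i))

SomePair : (ℕ → ℕ → Set) → List ℕ → Set
SomePair Q e = ∃[ i ] ∃[ j ] (i < j × j < length e × Q (at e i) (at e j))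

SomeTriple : (ℕ → ℕ → ℕ → Set) → List ℕ → Set
SomeTriple R e = ∃[ i ] ∃[ j ] ∃[ k ] (i < j × j < k × k < length e × R (at e i) (at e j) (at e k))

length-∷ʳ : ∀ (e : List ℕ) y → length (e ∷ʳ y) ≡ suc (length e)
length-∷ʳ e y = trans (length-++ e) (+-comm (length e) 1)

at-∷ʳ : ∀ e y {i} → i < length e → at (e ∷ʳ y) i ≡ at e i
at-∷ʳ (a ∷ e) y {zero} _ = refl
at-∷ʳ (a ∷ e) y {suc i} (s≤s i<n) = at-∷ʳ e y i<n

at-∷ʳ-last : ∀ e y → at (e ∷ʳ y) (length e) ≡ y
at-∷ʳ-last [] y = refl
at-∷ʳ-last (a ∷ e) y = at-∷ʳ-last e y

data IndexOf∷ʳ (e : List ℕ) : ℕ → Set where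
  old : ∀ {i} → i < length e → IndexOf∷ʳ e i
  new : IndexOf∷ʳ e (length e)

indexOf∷ʳ : ∀ e y {i} → i < length (e ∷ʳ y) → IndexOf∷ʳ e i
indexOf∷ʳ e y {i} i<n with m≤n⇒m<n∨m≡n (s≤s⁻¹ (subst (i <_) (length-∷ʳ e y) i<n))
... | inj₁ i<len = old i<len
... | inj₂ refl = new

<-length-∷ʳ : ∀ e y {i} → i < length e → i < length (e ∷ʳ y)
<-length-∷ʳ e y i<n = subst (_ <_) (sym (length-∷ʳ e y)) (m<n⇒m<1+n i<n)

length<length-∷ʳ : ∀ e y → length e < length (e ∷ʳ y)
length<length-∷ʳ e y = subst (_ <_) (sym (length-∷ʳ e y)) ≤-refl

∷ʳ-induction : (P : List ℕ → Set) → P [] → (∀ e y → P e → P (e ∷ʳ y)) → ∀ e → P e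
∷ʳ-induction P base extend e = go (reverseView e)
  where
  go : ∀ {e} → Reverse e → P e
  go [] = base
  go (e ∶ r ∶ʳ y) = extend e y (go r)

SomeEntry-∷ʳ : ∀ P e y → SomeEntry P (e ∷ʳ y) ⇔ (SomeEntry P e ⊎ P y)
SomeEntry-∷ʳ P e y = mk⇔ to from
  where
  to : SomeEntry P (e ∷ʳ y) → SomeEntry P e ⊎ P y
  to (i , i<n , p) with indexOf∷ʳ e y i<n
  ... | old i<m rewrite at-∷ʳ e y i<m = inj₁ (i , i<m , p)
  ... | new rewrite at-∷ʳ-last e y = inj₂ p
  from : SomeEntry P e ⊎ P y → SomeEntry P (e ∷ʳ y)
  from (inj₁ (i , i<m , p)) = i , <-length-∷ʳ e y i<m , subst P (sym (at-∷ʳ e y i<m)) p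
  from (inj₂ p) = length e , length<length-∷ʳ e y , subst P (sym (at-∷ʳ-last e y)) p

SomePair-∷ʳ : ∀ Q e y → SomePair Q (e ∷ʳ y) ⇔ (SomePair Q e ⊎ SomeEntry (λ a → Q a y) e)
SomePair-∷ʳ Q e y = mk⇔ to from
  where
  to : SomePair Q (e ∷ʳ y) → SomePair Q e ⊎ SomeEntry (λ a → Q a y) e
  to (i , j , i<j , j<n , q) with indexOf∷ʳ e y j<n
  ... | old j<m rewrite at-∷ʳ e y (<-trans i<j j<m) | at-∷ʳ e y j<m = inj₁ (i , j , i<j , j<m , q)
  ... | new rewrite at-∷ʳ e y i<j | at-∷ʳ-last e y = inj₂ (i , i<j , q)
  from : SomePair Q e ⊎ SomeEntry (λ a → Q a y) e → SomePair Q (e ∷ʳ y)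
  from (inj₁ (i , j , i<j , j<m , q)) =
    i , j , i<j , <-length-∷ʳ e y j<m ,
    subst₂ Q (sym (at-∷ʳ e y (<-trans i<j j<m))) (sym (at-∷ʳ e y j<m)) q
  from (inj₂ (i , i<m , q)) =
    i , length e , i<m , length<length-∷ʳ e y ,
    subst₂ Q (sym (at-∷ʳ e y i<m)) (sym (at-∷ʳ-last e y)) q

SomeTriple-∷ʳ : ∀ R e y → SomeTriple R (e ∷ʳ y) ⇔ (SomeTriple R e ⊎ SomePair (λ a b → R a b y) e)
SomeTriple-∷ʳ R e y = mk⇔ to from
  where
  to : SomeTriple R (e ∷ʳ y) → SomeTriple R e ⊎ SomePair (λ a b → R a b y) e
  to (i , j , k , i<j , j<k , k<n , r) with indexOf∷ʳ e y k<n
  ... | old k<m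
      rewrite at-∷ʳ e y (<-trans i<j (<-trans j<k k<m)) | at-∷ʳ e y (<-trans j<k k<m) | at-∷ʳ e y k<m
      = inj₁ (i , j , k , i<j , j<k , k<m , r)
  ... | new rewrite at-∷ʳ e y (<-trans i<j j<k) | at-∷ʳ e y j<k | at-∷ʳ-last e y =
    inj₂ (i , j , i<j , j<k , r)
  from : SomeTriple R e ⊎ SomePair (λ a b → R a b y) e → SomeTriple R (e ∷ʳ y)
  from (inj₁ (i , j , k , i<j , j<k , k<m , r)) = i , j , k , i<j , j<k , <-length-∷ʳ e y k<m , r′
    where
    r′ : R (at (e ∷ʳ y) i) (at (e ∷ʳ y) j) (at (e ∷ʳ y) k)
    r′ rewrite at-∷ʳ e y (<-trans i<j (<-trans j<k k<m)) | at-∷ʳ e y (<-trans j<k k<m) | at-∷ʳ e y k<m = r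
  from (inj₂ (i , j , i<j , j<m , r)) = i , j , length e , i<j , j<m , length<length-∷ʳ e y , r′
    where
    r′ : R (at (e ∷ʳ y) i) (at (e ∷ʳ y) j) (at (e ∷ʳ y) (length e))
    r′ rewrite at-∷ʳ e y (<-trans i<j j<m) | at-∷ʳ e y j<m | at-∷ʳ-last e y = r

SomeEntry-×ˡ : ∀ C P e → SomeEntry (λ a → C × P a) e ⇔ (C × SomeEntry P e)
SomeEntry-×ˡ C P e = mk⇔ (λ (i , i<n , c , p) → c , i , i<n , p) (λ (c , i , i<n , p) → i , i<n , c , p)

<-⊔-⇔ : ∀ x a b → (x < a ⊎ x < b) ⇔ x < a ⊔ b
<-⊔-⇔ x a b = mk⇔ [ m<n⇒m<n⊔o b , m<n⇒m<o⊔n a ] from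
  where
  from : x < a ⊔ b → x < a ⊎ x < b
  from x<a⊔b with ⊔-sel a b
  ... | inj₁ a⊔b≡a = inj₁ (subst (x <_) a⊔b≡a x<a⊔b)
  ... | inj₂ a⊔b≡b = inj₂ (subst (x <_) a⊔b≡b x<a⊔b)

<-⊓-⇔ : ∀ x a b → (x < a × x < b) ⇔ x < a ⊓ b
<-⊓-⇔ x a b = mk⇔ (λ (x<a , x<b) → ⊓-pres-m< x<a x<b) (λ x<a⊓b → m<n⊓o⇒m<n a b x<a⊓b , m<n⊓o⇒m<o a b x<a⊓b)

∧-≤?-≡false : ∀ b L y → (b ≡ false ⊎ y < L) ⇔ ((b ∧ does (L ≤? y)) ≡ false)
∧-≤?-≡false false L y = mk⇔ (λ _ → refl) (λ _ → inj₁ refl)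
∧-≤?-≡false true L y with L ≤? y
... | yes L≤y rewrite dec-true (L ≤? y) L≤y = mk⇔ [ (λ ()) , (λ y<L → contradiction L≤y (<⇒≱ y<L)) ] (λ ())
... | no L≰y rewrite dec-false (L ≤? y) L≰y = mk⇔ (λ _ → refl) (λ _ → inj₂ (≰⇒> L≰y))

¬-⇔-T : ∀ {A : Set} b → A ⇔ (b ≡ false) → (¬ A) ⇔ T b
¬-⇔-T true A⇔ = mk⇔ (λ _ → tt) (λ _ a → case Equivalence.to A⇔ a of λ ())
¬-⇔-T false A⇔ = mk⇔ (λ ¬a → ¬a (Equivalence.from A⇔ refl)) (λ ())

∑< : ℕ → (ℕ → ℕ) → ℕ
∑< n f = sum (applyUpTo f n)

∑<-cong : ∀ n {f g} → (∀ i → i < n → f i ≡ g i) → ∑< n f ≡ ∑< n g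
∑<-cong zero f≗g = refl
∑<-cong (suc n) f≗g = cong₂ _+_ (f≗g 0 z<s) (∑<-cong n (λ i i<n → f≗g (suc i) (s<s i<n)))

∑<-+ : ∀ m n f → ∑< (m + n) f ≡ ∑< m f + ∑< n (λ i → f (m + i))
∑<-+ zero n f = refl
∑<-+ (suc m) n f = trans (cong (f 0 +_) (∑<-+ m n (f ∘ suc))) (sym (+-assoc (f 0) _ _))

∑<-suc : ∀ n f → ∑< (suc n) f ≡ ∑< n f + f n
∑<-suc zero f = +-identityʳ (f 0)
∑<-suc (suc n) f = trans (cong (f 0 +_) (∑<-suc n (f ∘ suc))) (sym (+-assoc (f 0) _ _))

∑<-rotate : ∀ d {f g} → (∀ i → i < d → f i ≡ g (suc i)) → f d ≡ g 0 → ∑< (suc d) f ≡ ∑< (suc d) g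
∑<-rotate d {f} {g} shift wrap = begin
  ∑< (suc d) f            ≡⟨ ∑<-suc d f ⟩
  ∑< d f + f d            ≡⟨ cong₂ _+_ (∑<-cong d shift) wrap ⟩
  ∑< d (g ∘ suc) + g 0    ≡⟨ +-comm _ (g 0) ⟩
  ∑< (suc d) g            ∎
  where open ≡-Reasoning

∑<-rotate-block : ∀ {L M n} f g → L ≤ M → M ≤ n →
  (∀ x → x < L → f x ≡ g x) →
  (∀ x → L ≤ x → x < M → f x ≡ g (suc x)) →
  f M ≡ g L →
  (∀ x → M < x → x ≤ n → f x ≡ g x) →
  ∑< (suc n) f ≡ ∑< (suc n) g
∑<-rotate-block {L} {M} {n} f g L≤M M≤n below inside top above = begin
  ∑< (suc n) f                                  ≡⟨ split f ⟩
  ∑< L f + (∑< (suc d) (f ∘ (L +_)) + ∑< r (f ∘ shifted))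
    ≡⟨ cong₂ _+_ (∑<-cong L below) (cong₂ _+_ (∑<-rotate d {f ∘ (L +_)} {g ∘ (L +_)} inside′ top′) (∑<-cong r above′)) ⟩
  ∑< L g + (∑< (suc d) (g ∘ (L +_)) + ∑< r (g ∘ shifted))
                                                ≡⟨ split g ⟨
  ∑< (suc n) g                                  ∎
  where
  open ≡-Reasoning
  d = M ∸ L
  r = n ∸ M
  shifted : ℕ → ℕ
  shifted i = L + (suc d + i)
  shifted≡ : ∀ i → shifted i ≡ M + suc i
  shifted≡ i = begin
    L + (suc d + i)  ≡⟨ cong (L +_) (+-suc d i) ⟨
    L + (d + suc i)  ≡⟨ +-assoc L d (suc i) ⟨
    L + d + suc i    ≡⟨ cong (_+ suc i) (m+[n∸m]≡n L≤M) ⟩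
    M + suc i        ∎
  split : ∀ h → ∑< (suc n) h ≡ ∑< L h + (∑< (suc d) (h ∘ (L +_)) + ∑< r (h ∘ shifted))
  split h = begin
    ∑< (suc n) h               ≡⟨ cong (λ k → ∑< k h) length≡ ⟩
    ∑< (L + (suc d + r)) h     ≡⟨ ∑<-+ L (suc d + r) h ⟩
    ∑< L h + ∑< (suc d + r) (h ∘ (L +_))
                               ≡⟨ cong (∑< L h +_) (∑<-+ (suc d) r (h ∘ (L +_))) ⟩
    ∑< L h + (∑< (suc d) (h ∘ (L +_)) + ∑< r (h ∘ shifted)) ∎
    where
    length≡ : suc n ≡ L + (suc d + r)
    length≡ = sym (trans (shifted≡ r) (trans (+-suc M r) (cong suc (m+[n∸m]≡n M≤n))))
  inside′ : ∀ i → i < d → f (L + i) ≡ g (L + suc i)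
  inside′ i i<d = trans (inside (L + i) (m≤m+n L i) (subst (L + i <_) (m+[n∸m]≡n L≤M) (+-monoʳ-< L i<d)))
                        (cong g (sym (+-suc L i)))
  top′ : f (L + d) ≡ g (L + 0)
  top′ = trans (cong f (m+[n∸m]≡n L≤M)) (trans top (cong g (sym (+-identityʳ L))))
  above′ : ∀ i → i < r → f (shifted i) ≡ g (shifted i)
  above′ i i<r = above (shifted i) (subst (M <_) (sym (shifted≡ i)) (m<m+n M z<s))
                       (subst (_≤ n) (sym (shifted≡ i)) (subst (M + suc i ≤_) (m+[n∸m]≡n M≤n) (+-monoʳ-≤ M i<r)))

∑<-zero : ∀ n {f} → (∀ i → f i ≡ 0) → ∑< n f ≡ 0
∑<-zero zero f≡0 = refl
∑<-zero (suc n) f≡0 = cong₂ _+_ (f≡0 0) (∑<-zero n (f≡0 ∘ suc))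

sum-map-concatMap : ∀ {A B : Set} (f : B → ℕ) (g : A → List B) xs →
  sum (map f (concatMap g xs)) ≡ sum (map (sum ∘ map f ∘ g) xs)
sum-map-concatMap f g [] = refl
sum-map-concatMap f g (x ∷ xs) = begin
  sum (map f (g x ++ concatMap g xs))               ≡⟨ cong sum (map-++ f (g x) _) ⟩
  sum (map f (g x) ++ map f (concatMap g xs))       ≡⟨ sum-++ (map f (g x)) _ ⟩
  sum (map f (g x)) + sum (map f (concatMap g xs))  ≡⟨ cong (sum (map f (g x)) +_) (sum-map-concatMap f g xs) ⟩
  sum (map f (g x)) + sum (map (sum ∘ map f ∘ g) xs) ∎
  where open ≡-Reasoning

sum-map-if : ∀ {A : Set} (b : A → Bool) xs →
  sum (map (λ a → if b a then 1 else 0) xs) ≡ length (filter (T? ∘ b) xs)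
sum-map-if b [] = refl
sum-map-if b (x ∷ xs) with b x
... | true = cong suc (sum-map-if b xs)
... | false = sum-map-if b xs

module GeneratingTree {S : Set} (start : S) (step : S → ℕ → S) (accepts : S → Bool) where

  run : List ℕ → S
  run = foldl step start

  acceptedCount : ℕ → ℕ
  acceptedCount n = length (filter (T? ∘ accepts ∘ run) (invSeqs n))

  extensions : ℕ → ℕ → S → ℕ
  extensions zero n s = if accepts s then 1 else 0
  extensions (suc m) n s = ∑< (suc n) (λ x → extensions m (suc n) (step s x))

  extensions-sum : ∀ m n → sum (map (extensions m n ∘ run) (invSeqs n)) ≡ acceptedCount (m + n)
  extensions-sum zero n = sum-map-if (accepts ∘ run) (invSeqs n)
  extensions-sum (suc m) n = begin
    sum (map (extensions (suc m) n ∘ run) (invSeqs n))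
      ≡⟨ cong sum (map-cong (λ e → cong sum (sym children)) (invSeqs n)) ⟩
    sum (map (sum ∘ map (extensions m (suc n) ∘ run) ∘ appendings) (invSeqs n))
      ≡⟨ sum-map-concatMap (extensions m (suc n) ∘ run) appendings (invSeqs n) ⟨
    sum (map (extensions m (suc n) ∘ run) (invSeqs (suc n)))
      ≡⟨ extensions-sum m (suc n) ⟩
    acceptedCount (m + suc n)
      ≡⟨ cong acceptedCount (+-suc m n) ⟩
    acceptedCount (suc m + n) ∎
    where
    open ≡-Reasoning
    appendings : List ℕ → List (List ℕ)
    appendings e = map (e ∷ʳ_) (upTo (suc n))
    children : ∀ {e} → map (extensions m (suc n) ∘ run) (appendings e)
                     ≡ applyUpTo (λ x → extensions m (suc n) (step (run e) x)) (suc n)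
    children {e} = begin
      map (extensions m (suc n) ∘ run) (map (e ∷ʳ_) (upTo (suc n)))
        ≡⟨ map-∘ (upTo (suc n)) ⟨
      map (extensions m (suc n) ∘ run ∘ (e ∷ʳ_)) (upTo (suc n))
        ≡⟨ map-cong (λ x → cong (extensions m (suc n)) (foldl-∷ʳ step start x e)) (upTo (suc n)) ⟩
      map (λ x → extensions m (suc n) (step (run e) x)) (upTo (suc n))
        ≡⟨ map-upTo _ (suc n) ⟩
      applyUpTo (λ x → extensions m (suc n) (step (run e) x)) (suc n) ∎

  acceptedCount≡extensions : ∀ n → acceptedCount n ≡ extensions n 0 start
  acceptedCount≡extensions n = begin
    acceptedCount n                                      ≡⟨ cong acceptedCount (+-identityʳ n) ⟨
    acceptedCount (n + 0)                                ≡⟨ extensions-sum n 0 ⟨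
    sum (map (extensions n 0 ∘ run) (invSeqs 0))         ≡⟨ +-identityʳ _ ⟩
    extensions n 0 start                                 ∎
    where open ≡-Reasoning

  extensions-rejected : (∀ s x → accepts s ≡ false → accepts (step s x) ≡ false) →
    ∀ m n {s} → accepts s ≡ false → extensions m n s ≡ 0
  extensions-rejected closed zero n rejected rewrite rejected = refl
  extensions-rejected closed (suc m) n {s} rejected =
    ∑<-zero (suc n) (λ x → extensions-rejected closed m (suc n) (closed s x rejected))

  count≡acceptedCount : ∀ {P : List ℕ → Set} (P? : ∀ e → Dec (P e)) →
    (∀ e → P e ⇔ T (accepts (run e))) → ∀ n → count P P? n ≡ acceptedCount n
  count≡acceptedCount P? P⇔ n =
    cong length (filter-≐ P? (T? ∘ accepts ∘ run) ((λ {e} → Equivalence.to (P⇔ e)) , (λ {e} → Equivalence.from (P⇔ e))) (invSeqs n))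

Occ1-shape : ℕ → ℕ → ℕ → Set
Occ1-shape a b c = b > c × a > c

module Pattern₁ where

  record State : Set where
    constructor ⟨_,_,_⟩
    field
      alive   : Bool
      largest : ℕ
      bound   : ℕ
  open State public

  step : State → ℕ → State
  step ⟨ a , M , L ⟩ y = ⟨ a ∧ does (L ≤? y) , M ⊔ y , L ⊔ (y ⊓ M) ⟩

  open GeneratingTree ⟨ true , 0 , 0 ⟩ step alive public

  record Describes (e : List ℕ) (s : State) : Set where
    field
      largest-correct : ∀ x → SomeEntry (x <_) e ⇔ x < largest s
      bound-correct   : ∀ x → SomePair (λ a b → Occ1-shape a b x) e ⇔ x < bound s
      alive-correct   : Occ1 e ⇔ (alive s ≡ false)

  describes-[] : Describes [] ⟨ true , 0 , 0 ⟩
  describes-[] = record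
    { largest-correct = λ x → mk⇔ (λ { (_ , () , _) }) (λ ())
    ; bound-correct   = λ x → mk⇔ (λ { (_ , _ , _ , () , _) }) (λ ())
    ; alive-correct   = mk⇔ (λ { (_ , _ , _ , _ , _ , () , _) }) (λ ())
    }

  describes-∷ʳ : ∀ {e s} y → Describes e s → Describes (e ∷ʳ y) (step s y)
  describes-∷ʳ {e} {⟨ a , M , L ⟩} y d = record
    { largest-correct = λ x → begin
        SomeEntry (x <_) (e ∷ʳ y)      ∼⟨ SomeEntry-∷ʳ _ e y ⟩
        (SomeEntry (x <_) e ⊎ x < y)   ∼⟨ largest-correct x ⊎-⇔ ⇔-id _ ⟩
        (x < M ⊎ x < y)                ∼⟨ <-⊔-⇔ x M y ⟩
        x < M ⊔ y                      ∎
    ; bound-correct = λ x → begin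
        SomePair (λ a b → Occ1-shape a b x) (e ∷ʳ y)
          ∼⟨ SomePair-∷ʳ (λ a b → Occ1-shape a b x) e y ⟩
        (SomePair (λ a b → Occ1-shape a b x) e ⊎ SomeEntry (λ a → y > x × a > x) e)
          ∼⟨ bound-correct x ⊎-⇔ SomeEntry-×ˡ (y > x) (x <_) e ⟩
        (x < L ⊎ (x < y × SomeEntry (x <_) e))
          ∼⟨ ⇔-id _ ⊎-⇔ (⇔-id _ ×-⇔ largest-correct x) ⟩
        (x < L ⊎ (x < y × x < M))
          ∼⟨ ⇔-id _ ⊎-⇔ <-⊓-⇔ x y M ⟩
        (x < L ⊎ x < y ⊓ M)
          ∼⟨ <-⊔-⇔ x L (y ⊓ M) ⟩
        x < L ⊔ (y ⊓ M) ∎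
    ; alive-correct = begin
        Occ1 (e ∷ʳ y)                                     ∼⟨ SomeTriple-∷ʳ Occ1-shape e y ⟩
        (Occ1 e ⊎ SomePair (λ a b → Occ1-shape a b y) e)  ∼⟨ alive-correct ⊎-⇔ bound-correct y ⟩
        (a ≡ false ⊎ y < L)                               ∼⟨ ∧-≤?-≡false a L y ⟩
        (a ∧ does (L ≤? y)) ≡ false                       ∎
    }
    where
    open Describes d
    open EquationalReasoning {k = equivalence}

  describes : ∀ e → Describes e (run e)
  describes = ∷ʳ-induction (λ e → Describes e (run e)) describes-[]
    (λ e y d → subst (Describes (e ∷ʳ y)) (sym (foldl-∷ʳ step ⟨ true , 0 , 0 ⟩ y e)) (describes-∷ʳ y d))

  avoiders≡extensions : (avoid? : ∀ e → Dec (¬ Occ1 e)) → ∀ n →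
    count (λ e → ¬ Occ1 e) avoid? n ≡ extensions n 0 ⟨ true , 0 , 0 ⟩
  avoiders≡extensions avoid? n = begin
    count (λ e → ¬ Occ1 e) avoid? n
      ≡⟨ count≡acceptedCount avoid? (λ e → ¬-⇔-T (alive (run e)) (Describes.alive-correct (describes e))) n ⟩
    acceptedCount n
      ≡⟨ acceptedCount≡extensions n ⟩
    extensions n 0 ⟨ true , 0 , 0 ⟩ ∎
    where open ≡-Reasoning

  stays-rejected : ∀ s x → alive s ≡ false → alive (step s x) ≡ false
  stays-rejected s x rejected = cong (_∧ _) rejected

  dies : ∀ {a M L x} → x < L → alive (step ⟨ a , M , L ⟩ x) ≡ false
  dies {a} {L = L} {x} x<L rewrite dec-false (L ≤? x) (<⇒≱ x<L) = ∧-zeroʳ a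

  step-inside : ∀ {M L x} → L ≤ x → x ≤ M → step ⟨ true , M , L ⟩ x ≡ ⟨ true , M , x ⟩
  step-inside {M} {L} {x} L≤x x≤M
    rewrite dec-true (L ≤? x) L≤x | m≥n⇒m⊔n≡m x≤M | m≤n⇒m⊓n≡m x≤M | m≤n⇒m⊔n≡n L≤x = refl

  step-above : ∀ {M L x} → L ≤ M → M < x → step ⟨ true , M , L ⟩ x ≡ ⟨ true , x , M ⟩
  step-above {M} {L} {x} L≤M M<x
    rewrite dec-true (L ≤? x) (≤-trans L≤M (<⇒≤ M<x)) | m≤n⇒m⊔n≡n (<⇒≤ M<x)
          | m≥n⇒m⊓n≡n (<⇒≤ M<x) | m≤n⇒m⊔n≡n L≤M = refl

Occ2-shape : ℕ → ℕ → ℕ → Set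
Occ2-shape a b c = a ≢ b × b ≥ c × a > c

module Pattern₂ where

  -- For M the largest entry and R the largest entry different from M (0 if there
  -- is none), largestExcept M R w is the largest entry different from w, and
  -- insert M R y is the new pair (M, R) after appending y.
  largestExcept : ℕ → ℕ → ℕ → ℕ
  largestExcept M R w with w ≟ M
  ... | yes _ = R
  ... | no _ = M

  insert : ℕ → ℕ → ℕ → ℕ × ℕ
  insert M R y with <-cmp M y
  ... | tri< _ _ _ = y , M
  ... | tri≈ _ _ _ = M , R
  ... | tri> _ _ _ = M , R ⊔ y

  insert-< : ∀ {M R y} → M < y → insert M R y ≡ (y , M)
  insert-< {M} {R} {y} M<y with <-cmp M y
  ... | tri< _ _ _ = refl
  ... | tri≈ ¬M<y _ _ = contradiction M<y ¬M<y
  ... | tri> ¬M<y _ _ = contradiction M<y ¬M<y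

  insert-≡ : ∀ {M R} → insert M R M ≡ (M , R)
  insert-≡ {M} with <-cmp M M
  ... | tri< _ M≢M _ = contradiction refl M≢M
  ... | tri≈ _ _ _ = refl
  ... | tri> _ M≢M _ = contradiction refl M≢M

  insert-> : ∀ {M R y} → y < M → insert M R y ≡ (M , R ⊔ y)
  insert-> {M} {R} {y} y<M with <-cmp M y
  ... | tri< _ _ ¬y<M = contradiction y<M ¬y<M
  ... | tri≈ _ _ ¬y<M = contradiction y<M ¬y<M
  ... | tri> _ _ _ = refl

  insert-≤ : ∀ {M R} y → R ≤ M → proj₂ (insert M R y) ≤ proj₁ (insert M R y)
  insert-≤ {M} {R} y R≤M with <-cmp M y
  ... | tri< M<y _ _ = <⇒≤ M<y
  ... | tri≈ _ _ _ = R≤M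
  ... | tri> _ _ y<M = ⊔-lub R≤M (<⇒≤ y<M)

  largestExcept-≢ : ∀ {M R w} → w ≢ M → largestExcept M R w ≡ M
  largestExcept-≢ {M} {R} {w} w≢M with w ≟ M
  ... | yes w≡M = contradiction w≡M w≢M
  ... | no _ = refl

  largestExcept-≡ : ∀ {M R} → largestExcept M R M ≡ R
  largestExcept-≡ {M} with M ≟ M
  ... | yes _ = refl
  ... | no M≢M = contradiction refl M≢M

  largestExcept-≤ : ∀ {M R} w → R ≤ M → largestExcept M R w ≤ M
  largestExcept-≤ {M} w R≤M with w ≟ M
  ... | yes _ = R≤M
  ... | no _ = ≤-refl

  largestExcept-insert : ∀ {M R} x y w → R ≤ M →
    (x < largestExcept M R w ⊎ (y ≢ w × x < y)) ⇔ x < uncurry largestExcept (insert M R y) w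
  largestExcept-insert {M} {R} x y w R≤M with <-cmp M y
  ... | tri< M<y _ _ with w ≟ y
  ...   | yes refl rewrite largestExcept-≢ {R = R} (≢-sym (<⇒≢ M<y)) =
          mk⇔ [ id , (λ (y≢y , _) → contradiction refl y≢y) ] inj₁
  ...   | no w≢y = mk⇔ [ (λ x<K → <-≤-trans x<K (≤-trans (largestExcept-≤ w R≤M) (<⇒≤ M<y))) , proj₂ ]
                       (λ x<y → inj₂ (≢-sym w≢y , x<y))
  largestExcept-insert {M} {R} x y w R≤M | tri≈ _ refl _ =
    mk⇔ [ id , (λ (M≢w , x<M) → subst (x <_) (sym (largestExcept-≢ (≢-sym M≢w))) x<M) ] inj₁
  largestExcept-insert {M} {R} x y w R≤M | tri> _ _ y<M with w ≟ M
  ... | yes refl = ⇔-trans (mk⇔ [ inj₁ , inj₂ ∘ proj₂ ] [ inj₁ , (λ x<y → inj₂ (<⇒≢ y<M , x<y)) ]) (<-⊔-⇔ x R y)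
  ... | no _ = mk⇔ [ id , (λ (_ , x<y) → <-trans x<y y<M) ] inj₁

  record State : Set where
    constructor ⟨_,_,_,_⟩
    field
      alive    : Bool
      largest  : ℕ
      runnerUp : ℕ
      bound    : ℕ
  open State public

  step : State → ℕ → State
  step ⟨ a , M , R , L ⟩ y =
    ⟨ a ∧ does (L ≤? y) , proj₁ (insert M R y) , proj₂ (insert M R y) , L ⊔ (suc y ⊓ largestExcept M R y) ⟩

  open GeneratingTree ⟨ true , 0 , 0 , 0 ⟩ step alive public

  record Describes (e : List ℕ) (s : State) : Set where
    field
      runnerUp-≤            : runnerUp s ≤ largest s
      largestExcept-correct : ∀ x w → SomeEntry (λ a → a ≢ w × a > x) e
                                      ⇔ x < largestExcept (largest s) (runnerUp s) w
      bound-correct         : ∀ x → SomePair (λ a b → Occ2-shape a b x) e ⇔ x < bound s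
      alive-correct         : Occ2 e ⇔ (alive s ≡ false)

  describes-[] : Describes [] ⟨ true , 0 , 0 , 0 ⟩
  describes-[] = record
    { runnerUp-≤            = z≤n
    ; largestExcept-correct = λ x w → mk⇔ (λ { (_ , () , _) }) (λ x<K → contradiction (<-≤-trans x<K (largestExcept-≤ w z≤n)) λ ())
    ; bound-correct         = λ x → mk⇔ (λ { (_ , _ , _ , () , _) }) (λ ())
    ; alive-correct         = mk⇔ (λ { (_ , _ , _ , _ , _ , () , _) }) (λ ())
    }

  describes-∷ʳ : ∀ {e s} y → Describes e s → Describes (e ∷ʳ y) (step s y)
  describes-∷ʳ {e} {⟨ a , M , R , L ⟩} y d = record
    { runnerUp-≤ = insert-≤ y runnerUp-≤
    ; largestExcept-correct = λ x w → begin
        SomeEntry (λ a → a ≢ w × a > x) (e ∷ʳ y)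
          ∼⟨ SomeEntry-∷ʳ (λ a → a ≢ w × a > x) e y ⟩
        (SomeEntry (λ a → a ≢ w × a > x) e ⊎ (y ≢ w × y > x))
          ∼⟨ largestExcept-correct x w ⊎-⇔ ⇔-id _ ⟩
        (x < largestExcept M R w ⊎ (y ≢ w × x < y))
          ∼⟨ largestExcept-insert x y w runnerUp-≤ ⟩
        x < uncurry largestExcept (insert M R y) w ∎
    ; bound-correct = λ x → begin
        SomePair (λ a b → Occ2-shape a b x) (e ∷ʳ y)
          ∼⟨ SomePair-∷ʳ (λ a b → Occ2-shape a b x) e y ⟩
        (SomePair (λ a b → Occ2-shape a b x) e ⊎ SomeEntry (λ a → a ≢ y × y ≥ x × a > x) e)
          ∼⟨ bound-correct x ⊎-⇔ pull-out ⟩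
        (x < L ⊎ (x ≤ y × SomeEntry (λ a → a ≢ y × a > x) e))
          ∼⟨ ⇔-id _ ⊎-⇔ (mk⇔ s≤s s≤s⁻¹ ×-⇔ largestExcept-correct x y) ⟩
        (x < L ⊎ (x < suc y × x < largestExcept M R y))
          ∼⟨ ⇔-id _ ⊎-⇔ <-⊓-⇔ x (suc y) (largestExcept M R y) ⟩
        (x < L ⊎ x < suc y ⊓ largestExcept M R y)
          ∼⟨ <-⊔-⇔ x L _ ⟩
        x < L ⊔ (suc y ⊓ largestExcept M R y) ∎
    ; alive-correct = begin
        Occ2 (e ∷ʳ y)                                     ∼⟨ SomeTriple-∷ʳ Occ2-shape e y ⟩
        (Occ2 e ⊎ SomePair (λ a b → Occ2-shape a b y) e)  ∼⟨ alive-correct ⊎-⇔ bound-correct y ⟩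
        (a ≡ false ⊎ y < L)                               ∼⟨ ∧-≤?-≡false a L y ⟩
        (a ∧ does (L ≤? y)) ≡ false                       ∎
    }
    where
    open Describes d
    open EquationalReasoning {k = equivalence}
    pull-out : ∀ {x} → SomeEntry (λ a → a ≢ y × y ≥ x × a > x) e ⇔ (x ≤ y × SomeEntry (λ a → a ≢ y × a > x) e)
    pull-out = mk⇔ (λ (i , i<n , a≢y , x≤y , x<a) → x≤y , i , i<n , a≢y , x<a)
                   (λ (x≤y , i , i<n , a≢y , x<a) → i , i<n , a≢y , x≤y , x<a)

  describes : ∀ e → Describes e (run e)
  describes = ∷ʳ-induction (λ e → Describes e (run e)) describes-[]
    (λ e y d → subst (Describes (e ∷ʳ y)) (sym (foldl-∷ʳ step ⟨ true , 0 , 0 , 0 ⟩ y e)) (describes-∷ʳ y d))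

  avoiders≡extensions : (avoid? : ∀ e → Dec (¬ Occ2 e)) → ∀ n →
    count (λ e → ¬ Occ2 e) avoid? n ≡ extensions n 0 ⟨ true , 0 , 0 , 0 ⟩
  avoiders≡extensions avoid? n = begin
    count (λ e → ¬ Occ2 e) avoid? n
      ≡⟨ count≡acceptedCount avoid? (λ e → ¬-⇔-T (alive (run e)) (Describes.alive-correct (describes e))) n ⟩
    acceptedCount n
      ≡⟨ acceptedCount≡extensions n ⟩
    extensions n 0 ⟨ true , 0 , 0 , 0 ⟩ ∎
    where open ≡-Reasoning

  stays-rejected : ∀ s x → alive s ≡ false → alive (step s x) ≡ false
  stays-rejected s x rejected = cong (_∧ _) rejected

  dies : ∀ {a M R L x} → x < L → alive (step ⟨ a , M , R , L ⟩ x) ≡ false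
  dies {a} {L = L} {x} x<L rewrite dec-false (L ≤? x) (<⇒≱ x<L) = ∧-zeroʳ a

  step-inside : ∀ {M R L x} → L ≤ x → x < M → step ⟨ true , M , R , L ⟩ x ≡ ⟨ true , M , R ⊔ x , suc x ⟩
  step-inside {M} {R} {L} {x} L≤x x<M
    rewrite dec-true (L ≤? x) L≤x | insert-> {R = R} x<M | largestExcept-≢ {R = R} (<⇒≢ x<M)
          | m≤n⇒m⊓n≡m x<M | m≤n⇒m⊔n≡n (m≤n⇒m≤1+n L≤x) = refl

  step-largest : ∀ {M R L} → R ≤ L → L ≤ M → step ⟨ true , M , R , L ⟩ M ≡ ⟨ true , M , R , L ⟩
  step-largest {M} {R} {L} R≤L L≤M
    rewrite dec-true (L ≤? M) L≤M | insert-≡ {M} {R} | largestExcept-≡ {M} {R}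
          | m≥n⇒m⊓n≡n (m≤n⇒m≤1+n (≤-trans R≤L L≤M)) | m≥n⇒m⊔n≡m R≤L = refl

  step-above : ∀ {M R L x} → L ≤ M → M < x → step ⟨ true , M , R , L ⟩ x ≡ ⟨ true , x , M , M ⟩
  step-above {M} {R} {L} {x} L≤M M<x
    rewrite dec-true (L ≤? x) (≤-trans L≤M (<⇒≤ M<x)) | insert-< {R = R} M<x
          | largestExcept-≢ {R = R} (≢-sym (<⇒≢ M<x)) | m≥n⇒m⊓n≡n (m≤n⇒m≤1+n (<⇒≤ M<x)) | m≤n⇒m⊔n≡n L≤M = refl

module P₁ = Pattern₁
module P₂ = Pattern₂

extensions₂≡extensions₁ : ∀ m {n M R L} → R ≤ L → L ≤ M → M ≤ n →
  P₂.extensions m n P₂.⟨ true , M , R , L ⟩ ≡ P₁.extensions m n P₁.⟨ true , M , L ⟩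
extensions₂≡extensions₁ zero _ _ _ = refl
extensions₂≡extensions₁ (suc m) {n} {M} {R} {L} R≤L L≤M M≤n =
  ∑<-rotate-block child₂ child₁ L≤M M≤n below inside largest above
  where
  open ≡-Reasoning
  child₁ : ℕ → ℕ
  child₁ x = P₁.extensions m (suc n) (P₁.step P₁.⟨ true , M , L ⟩ x)
  child₂ : ℕ → ℕ
  child₂ x = P₂.extensions m (suc n) (P₂.step P₂.⟨ true , M , R , L ⟩ x)
  below : ∀ x → x < L → child₂ x ≡ child₁ x
  below x x<L = trans (P₂.extensions-rejected P₂.stays-rejected m (suc n) (P₂.dies {true} {M} {R} x<L))
                      (sym (P₁.extensions-rejected P₁.stays-rejected m (suc n) (P₁.dies {true} {M} x<L)))
  inside : ∀ x → L ≤ x → x < M → child₂ x ≡ child₁ (suc x)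
  inside x L≤x x<M = begin
    child₂ x
      ≡⟨ cong (P₂.extensions m (suc n)) (P₂.step-inside L≤x x<M) ⟩
    P₂.extensions m (suc n) P₂.⟨ true , M , R ⊔ x , suc x ⟩
      ≡⟨ extensions₂≡extensions₁ m (⊔-lub (≤-trans R≤L (m≤n⇒m≤1+n L≤x)) (n≤1+n x)) x<M (m≤n⇒m≤1+n M≤n) ⟩
    P₁.extensions m (suc n) P₁.⟨ true , M , suc x ⟩
      ≡⟨ cong (P₁.extensions m (suc n)) (P₁.step-inside (m≤n⇒m≤1+n L≤x) x<M) ⟨
    child₁ (suc x) ∎
  largest : child₂ M ≡ child₁ L
  largest = begin
    child₂ M
      ≡⟨ cong (P₂.extensions m (suc n)) (P₂.step-largest R≤L L≤M) ⟩
    P₂.extensions m (suc n) P₂.⟨ true , M , R , L ⟩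
      ≡⟨ extensions₂≡extensions₁ m R≤L L≤M (m≤n⇒m≤1+n M≤n) ⟩
    P₁.extensions m (suc n) P₁.⟨ true , M , L ⟩
      ≡⟨ cong (P₁.extensions m (suc n)) (P₁.step-inside ≤-refl L≤M) ⟨
    child₁ L ∎
  above : ∀ x → M < x → x ≤ n → child₂ x ≡ child₁ x
  above x M<x x≤n = begin
    child₂ x
      ≡⟨ cong (P₂.extensions m (suc n)) (P₂.step-above L≤M M<x) ⟩
    P₂.extensions m (suc n) P₂.⟨ true , x , M , M ⟩
      ≡⟨ extensions₂≡extensions₁ m ≤-refl (<⇒≤ M<x) (m≤n⇒m≤1+n x≤n) ⟩
    P₁.extensions m (suc n) P₁.⟨ true , x , M ⟩
      ≡⟨ cong (P₁.extensions m (suc n)) (P₁.step-above L≤M M<x) ⟨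
    child₁ x ∎

mainTheorem20 : (n : ℕ) → n ≥ 1 →
    (avoid1? : (e : List ℕ) → Dec (¬ Occ1 e)) →
    (avoid2? : (e : List ℕ) → Dec (¬ Occ2 e)) →
    count (λ e → ¬ Occ1 e) avoid1? n ≡ count (λ e → ¬ Occ2 e) avoid2? n
-- The identity holds for n = 0 as well.
mainTheorem20 n _ avoid1? avoid2? = begin
  count (λ e → ¬ Occ1 e) avoid1? n            ≡⟨ P₁.avoiders≡extensions avoid1? n ⟩
  P₁.extensions n 0 P₁.⟨ true , 0 , 0 ⟩       ≡⟨ extensions₂≡extensions₁ n z≤n z≤n z≤n ⟨
  P₂.extensions n 0 P₂.⟨ true , 0 , 0 , 0 ⟩   ≡⟨ P₂.avoiders≡extensions avoid2? n ⟨
  count (λ e → ¬ Occ2 e) avoid2? n            ∎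
  where open ≡-Reasoning
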